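{- Let $p>5$ be a prime, let $m>n>0$ be integers, and let $a\in\mathbb{F}_p^*$. If $f:=x^m+ax^n$ permutes $\mathbb{F}_p$ (i.e. the map $c\mapsto f(c)$ is a bijection of $\mathbb{F}_p$), then $\gcd(m-n,p-1)\notin\{2,4\}$. -}

module Defs where

open import Data.Nat using (ℕ; _+_; _*_; _^_; NonZero)
open import Data.Nat.DivMod using (_mod_)
open import Data.Fin using (Fin; toℕ)

-- The prime field F_p is modelled as Fin p (residues 0..p-1) with
-- arithmetic modulo p.  An element a of F_p is a residue in Fin p.
-- Polynomial map c ↦ c^m + a·c^n, evaluated in F_p.
binomialMap : (p : ℕ) .{{_ : NonZero p}} → (m n : ℕ) → Fin p → Fin p → Fin p
binomialMap p m n a c = ((toℕ c ^ m) + toℕ a * (toℕ c ^ n)) mod p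

{-# OPTIONS --safe #-}

-- By Hermite's criterion, if f permutes 𝔽_p then ∑_c f(c)^t = ∑_c c^t ≡ 0 for 0 < t < p − 1.
-- Expanding f(c)^t = c^(n t) (c^(m−n) + a)^t and using ∑_c c^k ≡ −[p − 1 ∣ k] for k > 0, this
-- says that the sum of C(t, j) a^(t−j) over the j ≤ t with p − 1 ∣ n t + (m − n) j vanishes mod p.
-- Write m − n = d e and p − 1 = d r with gcd(e, r) = 1. If d < r, then t = d u can be chosen with
-- u < r so that exactly one j qualifies, and the single surviving term is a unit mod p.
-- For d ∈ {2, 4} and p > 5 this leaves only d = 4 with p = 13 or p = 17 (p = 9 is not prime),
-- where the Hermite sums for all residues of n, m − n and a are checked by computation.

module Submission where

open import Defs
open import Data.Nat using (ℕ; _<_; _∸_; NonZero)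
open import Data.Nat.GCD using (gcd)
open import Data.Nat.Primality using (Prime)
open import Data.Fin using (Fin; toℕ)
open import Data.Sum using (_⊎_)
open import Relation.Nullary using (¬_)
open import Relation.Binary.PropositionalEquality using (_≡_)
open import Function.Definitions using (Bijective)

open import Level using (0ℓ)
open import Data.Bool.Base using (if_then_else_)
open import Data.Nat.Base
  using (zero; suc; _+_; _*_; _^_; _≤_; _!; _≡ᵇ_; z≤n; s≤s; s≤s⁻¹; z<s; s<s; s<s⁻¹;
         >-nonZero; >-nonZero⁻¹; nonTrivial⇒n>1)
open import Data.Nat.Properties
open import Data.Nat.DivMod
open import Data.Nat.Divisibility
open import Data.Nat.Combinatorics using (_C_; nCn≡1; nCk≡n!/k![n-k]!; k![n∸k]!∣n!)
open import Data.Nat.GCD using (gcd[m,n]∣m; gcd[m,n]∣n; gcd-greatest; module Bézout)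
open import Data.Nat.Coprimality as Coprimality
  using (Coprime; coprime-divisor; coprime-Bézout; coprime-/gcd; prime⇒coprime)
open import Data.Nat.Primality using (euclidsLemma; prime⇒nonTrivial; prime?)
open import Data.Nat.Induction using (<-rec)
open import Data.Nat.Solver using (module +-*-Solver)
open import Data.Fin.Base using (zero; suc; fromℕ; fromℕ<; inject₁; punchIn)
open import Data.Fin.Properties
  using (toℕ<n; toℕ-fromℕ; toℕ-fromℕ<; toℕ-inject₁; toℕ-injective; punchInᵢ≢i)
open import Data.Product using (∃-syntax; ∃₂; _×_; _,_; proj₁; proj₂)
open import Data.Sum using (inj₁; inj₂; [_,_]′)
open import Data.Empty using (⊥)
open import Function.Base using (_∘_; id; flip)
open import Function.Bundles using (mk⤖)
open import Function.Properties.Bijection using (⤖⇒↔)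
open import Relation.Nullary using (yes; no; contradiction)
open import Relation.Nullary.Decidable using (toSum; from-yes; from-no; _→-dec_; ¬?)
open import Relation.Binary.Bundles using (Setoid)
open import Relation.Binary.Structures using (IsEquivalence)
open import Relation.Binary.PropositionalEquality
  using (_≢_; refl; sym; trans; cong; cong₂; subst; subst₂; module ≡-Reasoning)
import Relation.Binary.Reasoning.Setoid as SetoidReasoning

open import Algebra.Properties.Semiring.Sum +-*-semiring
  using (sum; sum-syntax; sum⁺-syntax; sum-cong-≗; sum-replicate; sum-replicate-zero;
         sum-init-last; sum-remove; sum-permute; ∑-comm; *-distribˡ-sum; *-distribʳ-sum)
open import Algebra.Properties.Semiring.Mult +-*-semiring using () renaming (_×_ to _×ᴿ_)
open import Algebra.Properties.CommutativeSemiring.Exp +-*-commutativeSemiring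
  using () renaming (_^_ to _^ᴿ_; ^-distrib-* to ^ᴿ-distrib-*)
import Algebra.Properties.CommutativeSemiring.Binomial +-*-commutativeSemiring as Binomial

-- Sums and binomial coefficients in ℕ

×ᴿ≡* : ∀ m x → m ×ᴿ x ≡ m * x
×ᴿ≡* zero    x = refl
×ᴿ≡* (suc m) x = cong (x +_) (×ᴿ≡* m x)

^ᴿ≡^ : ∀ x m → x ^ᴿ m ≡ x ^ m
^ᴿ≡^ x zero    = refl
^ᴿ≡^ x (suc m) = cong (x *_) (^ᴿ≡^ x m)

^-distribʳ-* : ∀ x y m → (x * y) ^ m ≡ x ^ m * y ^ m
^-distribʳ-* x y m = begin
  (x * y) ^ m      ≡⟨ ^ᴿ≡^ (x * y) m ⟨
  (x * y) ^ᴿ m     ≡⟨ ^ᴿ-distrib-* x y m ⟩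
  x ^ᴿ m * y ^ᴿ m  ≡⟨ cong₂ _*_ (^ᴿ≡^ x m) (^ᴿ≡^ y m) ⟩
  x ^ m * y ^ m    ∎
  where open ≡-Reasoning

binomial-theorem : ∀ x y m →
  (x + y) ^ m ≡ ∑[ k ≤ m ] ((m C toℕ k) * (x ^ toℕ k * y ^ (m ∸ toℕ k)))
binomial-theorem x y m = begin
  (x + y) ^ m                       ≡⟨ ^ᴿ≡^ (x + y) m ⟨
  (x + y) ^ᴿ m                      ≡⟨ Binomial.theorem m x y ⟩
  Binomial.binomialExpansion x y m  ≡⟨ sum-cong-≗ {suc m} term≡ ⟩
  ∑[ k ≤ m ] ((m C toℕ k) * (x ^ toℕ k * y ^ (m ∸ toℕ k))) ∎
  where
  open ≡-Reasoning
  term≡ : ∀ k → (m C toℕ k) ×ᴿ (x ^ᴿ toℕ k * y ^ᴿ (m ∸ toℕ k))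
              ≡ (m C toℕ k) * (x ^ toℕ k * y ^ (m ∸ toℕ k))
  term≡ k = trans (×ᴿ≡* (m C toℕ k) _)
    (cong ((m C toℕ k) *_) (cong₂ _*_ (^ᴿ≡^ x (toℕ k)) (^ᴿ≡^ y (m ∸ toℕ k))))

sum-single : ∀ {N} (f : Fin N → ℕ) i → (∀ j → j ≢ i → f j ≡ 0) → sum f ≡ f i
sum-single {suc N} f i f≡0 = begin
  sum f                          ≡⟨ sum-remove {i = i} f ⟩
  f i + sum {N} (f ∘ punchIn i)
    ≡⟨ cong (f i +_) (sum-cong-≗ {N} λ j → f≡0 (punchIn i j) (punchInᵢ≢i i j)) ⟩
  f i + sum {N} (λ _ → 0)        ≡⟨ cong (f i +_) (sum-replicate-zero N) ⟩
  f i + 0                        ≡⟨ +-identityʳ (f i) ⟩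
  f i                            ∎
  where open ≡-Reasoning

sum-bijection : ∀ {N} {F : Fin N → Fin N} → Bijective _≡_ _≡_ F →
                (g : Fin N → ℕ) → ∑[ c < N ] g (F c) ≡ ∑[ c < N ] g c
sum-bijection bij g = sym (sum-permute g (⤖⇒↔ (mk⤖ bij)))

nCk*[k!*[n∸k]!]≡n! : ∀ {n k} → k ≤ n → (n C k) * (k ! * (n ∸ k) !) ≡ n !
nCk*[k!*[n∸k]!]≡n! {n} {k} k≤n =
  trans (cong (_* (k ! * (n ∸ k) !)) (nCk≡n!/k![n-k]! k≤n)) (m/n*n≡m (k![n∸k]!∣n! k≤n))
  where instance _ = k !* (n ∸ k) !≢0

powerSum : ℕ → ℕ → ℕ
powerSum N k = ∑[ c < N ] (toℕ c ^ k)

shifted-powerSum : ∀ N k → ∑[ c < N ] (suc (toℕ c) ^ suc k) ≡ powerSum N (suc k) + N ^ suc k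
shifted-powerSum N k = begin
  ∑[ c < N ] (suc (toℕ c) ^ suc k)
    ≡⟨ sum-init-last {N} (λ c → toℕ c ^ suc k) ⟩
  ∑[ c < N ] (toℕ (inject₁ c) ^ suc k) + toℕ (fromℕ N) ^ suc k
    ≡⟨ cong₂ _+_ (sum-cong-≗ {N} λ c → cong (_^ suc k) (toℕ-inject₁ c))
                 (cong (_^ suc k) (toℕ-fromℕ N)) ⟩
  powerSum N (suc k) + N ^ suc k
    ∎
  where open ≡-Reasoning

shifted-powerSum-binomial : ∀ N k →
  ∑[ c < N ] (suc (toℕ c) ^ k) ≡ ∑[ j ≤ k ] ((k C toℕ j) * powerSum N (toℕ j))
shifted-powerSum-binomial N k = begin
  ∑[ c < N ] (suc (toℕ c) ^ k)
    ≡⟨ sum-cong-≗ {N} (λ c → trans (cong (_^ k) (+-comm 1 (toℕ c))) (binomial-theorem (toℕ c) 1 k)) ⟩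
  ∑[ c < N ] ∑[ j ≤ k ] ((k C toℕ j) * (toℕ c ^ toℕ j * 1 ^ (k ∸ toℕ j)))
    ≡⟨ sum-cong-≗ {N} (λ c → sum-cong-≗ {suc k} λ j →
         cong ((k C toℕ j) *_) (drop-1^ (toℕ c ^ toℕ j) (k ∸ toℕ j))) ⟩
  ∑[ c < N ] ∑[ j ≤ k ] ((k C toℕ j) * toℕ c ^ toℕ j)
    ≡⟨ ∑-comm {N} {suc k} (λ c j → (k C toℕ j) * toℕ c ^ toℕ j) ⟩
  ∑[ j ≤ k ] ∑[ c < N ] ((k C toℕ j) * toℕ c ^ toℕ j)
    ≡⟨ sum-cong-≗ {suc k} (λ j → sym (*-distribˡ-sum {N} (k C toℕ j) (λ c → toℕ c ^ toℕ j))) ⟩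
  ∑[ j ≤ k ] ((k C toℕ j) * powerSum N (toℕ j))              ∎
  where
  open ≡-Reasoning
  drop-1^ : ∀ x e → x * 1 ^ e ≡ x
  drop-1^ x e = trans (cong (x *_) (^-zeroˡ e)) (*-identityʳ x)

-- Summing (c + 1)^(k+1) - c^(k+1) over c < N telescopes to N^(k+1).
powerSum-recurrence : ∀ N k → ∑[ j ≤ k ] ((suc k C toℕ j) * powerSum N (toℕ j)) ≡ N ^ suc k
powerSum-recurrence N k = +-cancelʳ-≡ (powerSum N (suc k)) _ _ (begin
  ∑[ j ≤ k ] g (toℕ j) + powerSum N (suc k)
    ≡⟨ cong₂ _+_ (sum-cong-≗ {suc k} λ j → cong g (toℕ-inject₁ j)) last≡ ⟨
  ∑[ j ≤ k ] g (toℕ (inject₁ j)) + g (toℕ (fromℕ (suc k)))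
    ≡⟨ sum-init-last {suc k} (g ∘ toℕ) ⟨
  ∑[ j ≤ suc k ] g (toℕ j)          ≡⟨ shifted-powerSum-binomial N (suc k) ⟨
  ∑[ c < N ] (suc (toℕ c) ^ suc k)  ≡⟨ shifted-powerSum N k ⟩
  powerSum N (suc k) + N ^ suc k    ≡⟨ +-comm _ (N ^ suc k) ⟩
  N ^ suc k + powerSum N (suc k)    ∎)
  where
  open ≡-Reasoning
  g : ℕ → ℕ
  g j = (suc k C j) * powerSum N j
  last≡ : g (toℕ (fromℕ (suc k))) ≡ powerSum N (suc k)
  last≡ rewrite toℕ-fromℕ k | nCn≡1 (suc k) = *-identityˡ _

-- The Hermite sum

-- Q ≡ −1 modulo Q + 1, so this is −[Q ∣ k] read in 𝔽_(Q+1).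
negIndicator : (Q : ℕ) .{{_ : NonZero Q}} → ℕ → ℕ
negIndicator Q k = if k % Q ≡ᵇ 0 then Q else 0

hermiteSum : (Q : ℕ) .{{_ : NonZero Q}} → (n s A t : ℕ) → ℕ
hermiteSum Q n s A t = ∑[ j ≤ t ] ((t C toℕ j) * A ^ (t ∸ toℕ j) * negIndicator Q (n * t + s * toℕ j))

binomial-power-expansion : ∀ s n A t x →
  (x ^ (s + n) + A * x ^ n) ^ t ≡ ∑[ j ≤ t ] ((t C toℕ j) * A ^ (t ∸ toℕ j) * x ^ (n * t + s * toℕ j))
binomial-power-expansion s n A t x = begin
  (x ^ (s + n) + A * x ^ n) ^ t    ≡⟨ cong (λ y → (y + A * x ^ n) ^ t) (^-distribˡ-+-* x s n) ⟩
  (x ^ s * x ^ n + A * x ^ n) ^ t  ≡⟨ cong (_^ t) (*-distribʳ-+ (x ^ n) (x ^ s) A) ⟨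
  ((x ^ s + A) * x ^ n) ^ t        ≡⟨ ^-distribʳ-* (x ^ s + A) (x ^ n) t ⟩
  (x ^ s + A) ^ t * (x ^ n) ^ t    ≡⟨ cong (_* (x ^ n) ^ t) (binomial-theorem (x ^ s) A t) ⟩
  (∑[ j ≤ t ] ((t C toℕ j) * ((x ^ s) ^ toℕ j * A ^ (t ∸ toℕ j)))) * (x ^ n) ^ t
    ≡⟨ *-distribʳ-sum {suc t} ((x ^ n) ^ t)
                      (λ j → (t C toℕ j) * ((x ^ s) ^ toℕ j * A ^ (t ∸ toℕ j))) ⟩
  ∑[ j ≤ t ] ((t C toℕ j) * ((x ^ s) ^ toℕ j * A ^ (t ∸ toℕ j)) * (x ^ n) ^ t)
    ≡⟨ sum-cong-≗ {suc t} (λ j → term≡ (t C toℕ j) (toℕ j)) ⟩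
  ∑[ j ≤ t ] ((t C toℕ j) * A ^ (t ∸ toℕ j) * x ^ (n * t + s * toℕ j)) ∎
  where
  open ≡-Reasoning
  open +-*-Solver
  term≡ : ∀ b j → b * ((x ^ s) ^ j * A ^ (t ∸ j)) * (x ^ n) ^ t ≡ b * A ^ (t ∸ j) * x ^ (n * t + s * j)
  term≡ b j = begin
    b * ((x ^ s) ^ j * A ^ (t ∸ j)) * (x ^ n) ^ t
      ≡⟨ solve 4 (λ b u a v → b :* (u :* a) :* v := b :* a :* (v :* u))
               refl b ((x ^ s) ^ j) (A ^ (t ∸ j)) ((x ^ n) ^ t) ⟩
    b * A ^ (t ∸ j) * ((x ^ n) ^ t * (x ^ s) ^ j)
      ≡⟨ cong (b * A ^ (t ∸ j) *_) (cong₂ _*_ (^-*-assoc x n t) (^-*-assoc x s j)) ⟩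
    b * A ^ (t ∸ j) * (x ^ (n * t) * x ^ (s * j))
      ≡⟨ cong (b * A ^ (t ∸ j) *_) (^-distribˡ-+-* x (n * t) (s * j)) ⟨
    b * A ^ (t ∸ j) * x ^ (n * t + s * j) ∎

negIndicator-∣ : ∀ Q .{{_ : NonZero Q}} {k} → Q ∣ k → negIndicator Q k ≡ Q
negIndicator-∣ Q {k} Q∣k = cong (λ r → if r ≡ᵇ 0 then Q else 0) (n∣m⇒m%n≡0 k Q Q∣k)

negIndicator-∤ : ∀ Q .{{_ : NonZero Q}} {k} → Q ∤ k → negIndicator Q k ≡ 0
negIndicator-∤ Q {k} Q∤k with k % Q in eq
... | zero  = contradiction (m%n≡0⇒n∣m k Q eq) Q∤k
... | suc _ = refl

∣∧<⇒≡0 : ∀ {r k} → r ∣ k → k < r → k ≡ 0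
∣∧<⇒≡0 {k = zero}  _   _   = refl
∣∧<⇒≡0 {k = suc _} r∣k k<r = contradiction r∣k (>⇒∤ k<r)

∣-gap≡0 : ∀ {N e r a b} → Coprime e r → a ≤ b → b ∸ a < r →
          r ∣ N + e * a → r ∣ N + e * b → b ∸ a ≡ 0
∣-gap≡0 {N} {e} {r} {a} {b} e⊥r a≤b b∸a<r r∣a r∣b =
  ∣∧<⇒≡0 (coprime-divisor (Coprimality.sym e⊥r) (∣m+n∣m⇒∣n (subst (r ∣_) split r∣b) r∣a))
         b∸a<r
  where
  open ≡-Reasoning
  split : N + e * b ≡ N + e * a + e * (b ∸ a)
  split = begin
    N + e * b                    ≡⟨ cong (λ y → N + e * y) (m+[n∸m]≡n a≤b) ⟨
    N + e * (a + (b ∸ a))        ≡⟨ cong (N +_) (*-distribˡ-+ e a (b ∸ a)) ⟩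
    N + (e * a + e * (b ∸ a))    ≡⟨ +-assoc N (e * a) (e * (b ∸ a)) ⟨
    N + e * a + e * (b ∸ a)      ∎

∣-window-unique : ∀ {N e r x j} → Coprime e r → x < r → j < x + r →
                  r ∣ N + e * x → r ∣ N + e * j → j ≡ x
∣-window-unique {r = r} {x} {j} e⊥r x<r j<x+r r∣x r∣j with ≤-total x j
... | inj₁ x≤j = ≤-antisym (m∸n≡0⇒m≤n (∣-gap≡0 e⊥r x≤j j∸x<r r∣x r∣j)) x≤j
  where
  j∸x<r : j ∸ x < r
  j∸x<r = m<n+o⇒m∸n<o j x {{>-nonZero (≤-<-trans z≤n x<r)}} j<x+r
... | inj₂ j≤x =
  ≤-antisym j≤x (m∸n≡0⇒m≤n (∣-gap≡0 e⊥r j≤x (≤-<-trans (m∸n≤m x j) x<r) r∣j r∣x))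

-- Bézout gives x with x e ≡ ±1 (mod r); c is n x or n (r − 1) x accordingly.
coprime⇒solvable : ∀ {e r} .{{_ : NonZero r}} n → Coprime e r → ∃[ c ] r ∣ n + e * c
coprime⇒solvable {e} {r@(suc r′)} n e⊥r with coprime-Bézout e⊥r
... | Bézout.-+ x y 1+xe≡yr = n * x , divides (n * y) (begin
  n + e * (n * x)  ≡⟨ solve 3 (λ n e x → n :+ e :* (n :* x) := n :* (con 1 :+ x :* e)) refl n e x ⟩
  n * (1 + x * e)  ≡⟨ cong (n *_) 1+xe≡yr ⟩
  n * (y * r)      ≡⟨ *-assoc n y r ⟨
  n * y * r        ∎)
  where
  open ≡-Reasoning
  open +-*-Solver
... | Bézout.+- x y 1+yr≡xe = n * r′ * x , divides (n + n * r′ * y) (begin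
  n + e * (n * r′ * x)      ≡⟨ cong (n +_) (solve 4 (λ e n r x → e :* (n :* r :* x) := n :* r :* (x :* e))
                                                  refl e n r′ x) ⟩
  n + n * r′ * (x * e)      ≡⟨ cong (λ z → n + n * r′ * z) 1+yr≡xe ⟨
  n + n * r′ * (1 + y * r)  ≡⟨ solve 3 (λ n r y → n :+ n :* r :* (con 1 :+ y :* (con 1 :+ r))
                                                  := (n :+ n :* r :* y) :* (con 1 :+ r)) refl n r′ y ⟩
  (n + n * r′ * y) * r      ∎)
  where
  open ≡-Reasoning
  open +-*-Solver

hermiteSum-single : ∀ {Q d r e n s u x} .{{_ : NonZero Q}} .{{_ : NonZero d}} A →
  Q ≡ d * r → s ≡ d * e → Coprime e r → r ∣ n * u + e * x → x < r → x ≤ d * u → d * u < x + r →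
  hermiteSum Q n s A (d * u) ≡ (d * u C x) * A ^ (d * u ∸ x) * Q
hermiteSum-single {Q} {d} {r} {e} {n} {s} {u} {x} A Q≡dr s≡de e⊥r r∣x x<r x≤t t<x+r = begin
  hermiteSum Q n s A t
    ≡⟨ sum-single {suc t} (term ∘ toℕ) i (λ j j≢i → term≡0 j (j≢i ∘ toℕ≡x⇒≡i j)) ⟩
  term (toℕ i)          ≡⟨ cong term (toℕ-fromℕ< (s≤s x≤t)) ⟩
  term x                ≡⟨ cong ((t C x) * A ^ (t ∸ x) *_) (negIndicator-∣ Q (Q∣ r∣x)) ⟩
  (t C x) * A ^ (t ∸ x) * Q ∎
  where
  open ≡-Reasoning
  t : ℕ
  t = d * u
  term : ℕ → ℕ
  term j = (t C j) * A ^ (t ∸ j) * negIndicator Q (n * t + s * j)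
  i : Fin (suc t)
  i = fromℕ< (s≤s x≤t)
  toℕ≡x⇒≡i : ∀ j → toℕ j ≡ x → j ≡ i
  toℕ≡x⇒≡i j eq = toℕ-injective (trans eq (sym (toℕ-fromℕ< (s≤s x≤t))))
  exponent≡ : ∀ j → n * t + s * j ≡ d * (n * u + e * j)
  exponent≡ j = trans (cong (λ y → n * t + y * j) s≡de)
    (solve 5 (λ n d u e j → n :* (d :* u) :+ d :* e :* j := d :* (n :* u :+ e :* j)) refl n d u e j)
    where open +-*-Solver
  Q∣ : ∀ {j} → r ∣ n * u + e * j → Q ∣ n * t + s * j
  Q∣ {j} = subst₂ _∣_ (sym Q≡dr) (sym (exponent≡ j)) ∘ *-monoʳ-∣ d
  r∣ : ∀ {j} → Q ∣ n * t + s * j → r ∣ n * u + e * j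
  r∣ {j} = *-cancelˡ-∣ d ∘ subst₂ _∣_ Q≡dr (exponent≡ j)
  term≡0 : ∀ (j : Fin (suc t)) → toℕ j ≢ x → term (toℕ j) ≡ 0
  term≡0 j j≢x = trans (cong ((t C toℕ j) * A ^ (t ∸ toℕ j) *_) (negIndicator-∤ Q Q∤))
                       (*-zeroʳ ((t C toℕ j) * A ^ (t ∸ toℕ j)))
    where
    Q∤ : Q ∤ n * t + s * toℕ j
    Q∤ = j≢x ∘ ∣-window-unique e⊥r x<r (≤-<-trans (s≤s⁻¹ (toℕ<n j)) t<x+r) r∣x ∘ r∣

∣-scale-% : ∀ {r n e c} .{{_ : NonZero r}} u → r ∣ n + e * c → r ∣ n * u + e * ((u * c) % r)
∣-scale-% {r} {n} {e} {c} u r∣n+ec =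
  ∣m+n∣m⇒∣n (subst (r ∣_) split (∣n⇒∣m*n u r∣n+ec)) (n∣m*n (e * ((u * c) / r)))
  where
  open ≡-Reasoning
  open +-*-Solver
  split : u * (n + e * c) ≡ e * ((u * c) / r) * r + (n * u + e * ((u * c) % r))
  split = begin
    u * (n + e * c)
      ≡⟨ solve 4 (λ u n e c → u :* (n :+ e :* c) := n :* u :+ e :* (u :* c)) refl u n e c ⟩
    n * u + e * (u * c)
      ≡⟨ cong (λ y → n * u + e * y) (m≡m%n+[m/n]*n (u * c) r) ⟩
    n * u + e * ((u * c) % r + (u * c) / r * r)
      ≡⟨ solve 6 (λ n u e x q r → n :* u :+ e :* (x :+ q :* r) := e :* q :* r :+ (n :* u :+ e :* x))
               refl n u e ((u * c) % r) ((u * c) / r) r ⟩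
    e * ((u * c) / r) * r + (n * u + e * ((u * c) % r)) ∎

m<r+r⇒m≤m%r+r : ∀ m r .{{_ : NonZero r}} → m < r + r → m ≤ m % r + r
m<r+r⇒m≤m%r+r m r m<r+r = begin
  m                  ≡⟨ m≡m%n+[m/n]*n m r ⟩
  m % r + m / r * r  ≤⟨ +-monoʳ-≤ (m % r) (*-monoˡ-≤ r (s≤s⁻¹ m/r<2)) ⟩
  m % r + 1 * r      ≡⟨ cong (m % r +_) (*-identityˡ r) ⟩
  m % r + r          ∎
  where
  open ≤-Reasoning
  m/r<2 : m / r < 2
  m/r<2 = m<n*o⇒m/o<n (subst (m <_) (cong (r +_) (sym (+-identityʳ r))) m<r+r)

-- As x ≤ d u < x + r for x = u c mod r, j = x is the only j ≤ d u with j ≡ x (mod r).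
record Window (d r c : ℕ) .{{_ : NonZero r}} : Set where
  field
    u      : ℕ
    0<u    : 0 < u
    u<r    : u < r
    x≤du   : (u * c) % r ≤ d * u
    du<x+r : d * u < (u * c) % r + r

module _ (d r c : ℕ) .{{_ : NonZero r}} (2≤d : 2 ≤ d) (d<r : d < r) where

  private
    X : ℕ → ℕ
    X k = (k * c) % r

  window-1 : X 1 ≤ d * 1 → Window d r c
  window-1 X1≤d = record
    { u      = 1
    ; 0<u    = z<s
    ; u<r    = <-trans 2≤d d<r
    ; x≤du   = X1≤d
    ; du<x+r = <-≤-trans (subst (_< r) (sym (*-identityʳ d)) d<r) (m≤n+m r (X 1))
    }

  window-step : d < c % r → ∀ k → d * k < X k → d * suc k < X (suc k) + r
  window-step d<c%r k dk<Xk = begin-strict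
    d * suc k              ≡⟨ *-suc d k ⟩
    d + d * k              <⟨ +-mono-< d<c%r dk<Xk ⟩
    c % r + X k            ≤⟨ m<r+r⇒m≤m%r+r (c % r + X k) r (+-mono-< (m%n<n c r) (m%n<n (k * c) r)) ⟩
    (c % r + X k) % r + r  ≡⟨ cong (_+ r) (%-distribˡ-+ c (k * c) r) ⟨
    X (suc k) + r          ∎
    where open ≤-Reasoning

  -- Descend while X k ≤ d k holds; where it first fails at k − 1, window-step makes k a valid u.
  window-search : d < c % r → ∀ k → 0 < k → k < r → X k ≤ d * k → Window d r c
  window-search d<c%r (suc zero)     _ _   X≤dk = window-1 X≤dk
  window-search d<c%r (suc (suc k)) _ k<r X≤dk =
    [ window-search d<c%r (suc k) z<s (<-trans (n<1+n (suc k)) k<r)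
    , (λ X≰ → record
        { u      = suc (suc k)
        ; 0<u    = z<s
        ; u<r    = k<r
        ; x≤du   = X≤dk
        ; du<x+r = window-step d<c%r (suc k) (≰⇒> X≰)
        })
    ]′ (toSum (X (suc k) ≤? d * suc k))

window : ∀ d r c .{{_ : NonZero r}} → 2 ≤ d → d < r → Window d r c
window d r@(suc r′) c 2≤d d<r with c % r ≤? d
... | yes c%r≤d = window-1 d r c 2≤d d<r
                    (subst₂ _≤_ (cong (_% r) (sym (*-identityˡ c))) (sym (*-identityʳ d)) c%r≤d)
... | no  c%r≰d = window-search d r c 2≤d d<r (≰⇒> c%r≰d) r′ 0<r′ ≤-refl Xr′≤dr′
  where
  0<r′ : 0 < r′
  0<r′ = ≤-trans (s≤s z≤n) (≤-trans 2≤d (s≤s⁻¹ d<r))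
  Xr′≤dr′ : (r′ * c) % r ≤ d * r′
  Xr′≤dr′ = ≤-trans (s≤s⁻¹ (m%n<n (r′ * c) r)) (≤-trans (m≤n*m r′ 2) (*-monoˡ-≤ r′ 2≤d))

-- Congruence modulo p

module Modulo (p : ℕ) .{{_ : NonZero p}} where

  infix 4 _≈_
  record _≈_ (a b : ℕ) : Set where
    constructor mk≈
    field %-≡ : a % p ≡ b % p
  open _≈_ public

  ≈-isEquivalence : IsEquivalence _≈_
  ≈-isEquivalence = record
    { refl  = mk≈ refl
    ; sym   = λ (mk≈ eq) → mk≈ (sym eq)
    ; trans = λ (mk≈ eq) (mk≈ eq′) → mk≈ (trans eq eq′)
    }

  ≈-setoid : Setoid 0ℓ 0ℓ
  ≈-setoid = record { Carrier = ℕ ; _≈_ = _≈_ ; isEquivalence = ≈-isEquivalence }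

  open IsEquivalence ≈-isEquivalence public
    using () renaming (refl to ≈-refl; sym to ≈-sym; trans to ≈-trans)

  module ≈-Reasoning = SetoidReasoning ≈-setoid

  ≡⇒≈ : ∀ {a b} → a ≡ b → a ≈ b
  ≡⇒≈ refl = ≈-refl

  %-≈ : ∀ a → a % p ≈ a
  %-≈ a = mk≈ (m%n%n≡m%n a p)

  +-cong : ∀ {a b c d} → a ≈ b → c ≈ d → a + c ≈ b + d
  +-cong {a} {b} {c} {d} (mk≈ a≈b) (mk≈ c≈d) = mk≈ (begin
    (a + c) % p          ≡⟨ %-distribˡ-+ a c p ⟩
    (a % p + c % p) % p  ≡⟨ cong₂ (λ x y → (x + y) % p) a≈b c≈d ⟩
    (b % p + d % p) % p  ≡⟨ %-distribˡ-+ b d p ⟨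
    (b + d) % p          ∎)
    where open ≡-Reasoning

  *-cong : ∀ {a b c d} → a ≈ b → c ≈ d → a * c ≈ b * d
  *-cong {a} {b} {c} {d} (mk≈ a≈b) (mk≈ c≈d) = mk≈ (begin
    (a * c) % p            ≡⟨ %-distribˡ-* a c p ⟩
    (a % p * (c % p)) % p  ≡⟨ cong₂ (λ x y → (x * y) % p) a≈b c≈d ⟩
    (b % p * (d % p)) % p  ≡⟨ %-distribˡ-* b d p ⟨
    (b * d) % p            ∎)
    where open ≡-Reasoning

  ^-congˡ : ∀ {a b} k → a ≈ b → a ^ k ≈ b ^ k
  ^-congˡ zero    _   = ≈-refl
  ^-congˡ (suc k) a≈b = *-cong a≈b (^-congˡ k a≈b)

  sum-cong : ∀ {N} {f g : Fin N → ℕ} → (∀ i → f i ≈ g i) → sum f ≈ sum g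
  sum-cong {zero}  _   = ≈-refl
  sum-cong {suc N} f≈g = +-cong (f≈g zero) (sum-cong (f≈g ∘ suc))

  sum≈0 : ∀ {N} {f : Fin N → ℕ} → (∀ i → f i ≈ 0) → sum f ≈ 0
  sum≈0 {N} f≈0 = ≈-trans (sum-cong f≈0) (≡⇒≈ (sum-replicate-zero N))

  ∣⇒≈0 : ∀ {a} → p ∣ a → a ≈ 0
  ∣⇒≈0 {a} p∣a = mk≈ (trans (n∣m⇒m%n≡0 a p p∣a) (sym (m*n%n≡0 0 p)))

  ≈0⇒∣ : ∀ {a} → a ≈ 0 → p ∣ a
  ≈0⇒∣ {a} (mk≈ eq) = m%n≡0⇒n∣m a p (trans eq (m*n%n≡0 0 p))

  ≈⇒∣∸ : ∀ {a b} → a ≈ b → p ∣ a ∸ b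
  ≈⇒∣∸ {a} {b} (mk≈ eq) = divides (a / p ∸ b / p) (begin
    a ∸ b                                      ≡⟨ cong₂ _∸_ (m≡m%n+[m/n]*n a p) (m≡m%n+[m/n]*n b p) ⟩
    (a % p + a / p * p) ∸ (b % p + b / p * p)  ≡⟨ cong (λ r → (a % p + a / p * p) ∸ (r + b / p * p)) eq ⟨
    (a % p + a / p * p) ∸ (a % p + b / p * p)  ≡⟨ [m+n]∸[m+o]≡n∸o (a % p) _ _ ⟩
    a / p * p ∸ b / p * p                      ≡⟨ *-distribʳ-∸ p (a / p) (b / p) ⟨
    (a / p ∸ b / p) * p                        ∎)
    where open ≡-Reasoning

  ∣∸⇒≈ : ∀ {a b} → b ≤ a → p ∣ a ∸ b → a ≈ b
  ∣∸⇒≈ {a} {b} b≤a p∣a∸b =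
    mk≈ (trans (cong (_% p) (sym (m+[n∸m]≡n b≤a))) (%-remove-+ʳ b p∣a∸b))

  *-cancelˡ-≈ : ∀ {x a b} → Coprime p x → x * a ≈ x * b → a ≈ b
  *-cancelˡ-≈ {x} {a} {b} p⊥x xa≈xb =
    [ (λ b≤a → ∣∸⇒≈ b≤a (cancel a b (≈⇒∣∸ xa≈xb)))
    , (λ a≤b → ≈-sym (∣∸⇒≈ a≤b (cancel b a (≈⇒∣∸ (≈-sym xa≈xb)))))
    ]′ (≤-total b a)
    where
    cancel : ∀ a b → p ∣ x * a ∸ x * b → p ∣ a ∸ b
    cancel a b = coprime-divisor p⊥x ∘ subst (p ∣_) (sym (*-distribˡ-∸ x a b))

hermiteSum-% : ∀ Q .{{_ : NonZero Q}} n s A t →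
               hermiteSum Q n s A t ≡ hermiteSum Q (n % Q) (s % Q) A t
hermiteSum-% Q n s A t = sum-cong-≗ {suc t} λ j →
  cong (λ k → (t C toℕ j) * A ^ (t ∸ toℕ j) * (if k ≡ᵇ 0 then Q else 0))
       (%-≡ (+-cong (*-cong (≈-sym (%-≈ n)) (≈-refl {t})) (*-cong (≈-sym (%-≈ s)) (≈-refl {toℕ j}))))
  where open Modulo Q

-- The prime field 𝔽_p, p = Q + 1

module PrimeField (Q : ℕ) (p-prime : Prime (suc Q)) where

  p : ℕ
  p = suc Q

  open Modulo p public

  1<p : 1 < p
  1<p = nonTrivial⇒n>1 p {{prime⇒nonTrivial p-prime}}

  instance
    Q-nonZero : NonZero Q
    Q-nonZero = >-nonZero (s<s⁻¹ 1<p)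

  p∤* : ∀ {x y} → p ∤ x → p ∤ y → p ∤ x * y
  p∤* p∤x p∤y p∣xy = [ p∤x , p∤y ]′ (euclidsLemma _ _ p-prime p∣xy)

  p∣*⇒∣ˡ : ∀ {x y} → p ∤ y → p ∣ x * y → p ∣ x
  p∣*⇒∣ˡ p∤y p∣xy = [ id , flip contradiction p∤y ]′ (euclidsLemma _ _ p-prime p∣xy)

  p∣*⇒∣ʳ : ∀ {x y} → p ∤ x → p ∣ x * y → p ∣ y
  p∣*⇒∣ʳ p∤x p∣xy = [ flip contradiction p∤x , id ]′ (euclidsLemma _ _ p-prime p∣xy)

  p∤unit : ∀ {x} → 0 < x → x < p → p ∤ x
  p∤unit {suc _} _ x<p = >⇒∤ x<p

  p∤^ : ∀ {x} k → p ∤ x → p ∤ x ^ k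
  p∤^ zero    _   = >⇒∤ 1<p
  p∤^ (suc k) p∤x = p∤* p∤x (p∤^ k p∤x)

  p∤! : ∀ {n} → n < p → p ∤ n !
  p∤! {zero}  _   = >⇒∤ 1<p
  p∤! {suc n} n<p = p∤* (p∤unit z<s n<p) (p∤! (<-trans (n<1+n n) n<p))

  p∤C : ∀ {n k} → n < p → k ≤ n → p ∤ n C k
  p∤C {n} {k} n<p k≤n p∣C =
    p∤! n<p (subst (p ∣_) (nCk*[k!*[n∸k]!]≡n! k≤n) (∣m⇒∣m*n (k ! * (n ∸ k) !) p∣C))

  p∣pC : ∀ {k} → 0 < k → k < p → p ∣ p C k
  p∣pC {suc k} _ k<p = p∣*⇒∣ˡ p∤!*! p∣p!
    where
    p∣p! : p ∣ (p C suc k) * (suc k ! * (p ∸ suc k) !)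
    p∣p! = subst (p ∣_) (sym (nCk*[k!*[n∸k]!]≡n! (<⇒≤ k<p))) (m∣m*n (Q !))
    p∤!*! : p ∤ suc k ! * (p ∸ suc k) !
    p∤!*! = p∤* (p∤! k<p) (p∤! (s<s (m∸n≤m Q k)))

  freshman : ∀ x → suc x ^ p ≈ x ^ p + 1
  freshman x = begin
    suc x ^ p                                         ≡⟨ binomial-theorem 1 x p ⟩
    T zero + sum (T ∘ suc)                            ≡⟨ cong (T zero +_) (sum-init-last {Q} (T ∘ suc)) ⟩
    T zero + (∑[ j < Q ] T (suc (inject₁ j)) + T (fromℕ p))
      ≈⟨ +-cong (≈-refl {T zero}) (+-cong (sum≈0 middle≈0) (≈-refl {T (fromℕ p)})) ⟩
    T zero + (0 + T (fromℕ p))                        ≡⟨ cong₂ _+_ first≡ last≡ ⟩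
    x ^ p + 1                                         ∎
    where
    open ≈-Reasoning
    T : Fin (suc p) → ℕ
    T j = (p C toℕ j) * (1 ^ toℕ j * x ^ (p ∸ toℕ j))
    middle≈0 : ∀ j → T (suc (inject₁ j)) ≈ 0
    middle≈0 j =
      ∣⇒≈0 (∣m⇒∣m*n _ (p∣pC z<s (s<s (subst (_< Q) (sym (toℕ-inject₁ j)) (toℕ<n j)))))
    first≡ : T zero ≡ x ^ p
    first≡ = trans (*-identityˡ _) (*-identityˡ _)
    last≡ : T (fromℕ p) ≡ 1
    last≡ = trans (cong (λ j → (p C j) * (1 ^ j * x ^ (p ∸ j))) (toℕ-fromℕ p))
                  (cong₂ _*_ (nCn≡1 p) (cong₂ _*_ (^-zeroˡ p) (cong (x ^_) (n∸n≡0 p))))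

  fermat : ∀ x → x ^ p ≈ x
  fermat zero    = ≈-refl
  fermat (suc x) = ≈-trans (freshman x) (≈-trans (+-cong (fermat x) (≈-refl {1})) (≡⇒≈ (+-comm x 1)))

  fermat-unit : ∀ {x} → 0 < x → x < p → x ^ Q ≈ 1
  fermat-unit {suc x} _ x<p =
    *-cancelˡ-≈ (prime⇒coprime p-prime x<p) (≈-trans (fermat (suc x)) (≡⇒≈ (sym (*-identityʳ (suc x)))))

  ^-%Q : ∀ {x} k → 0 < x → x < p → x ^ k ≈ x ^ (k % Q)
  ^-%Q {x} k 0<x x<p = begin
    x ^ k                            ≡⟨ cong (x ^_) (m≡m%n+[m/n]*n k Q) ⟩
    x ^ (k % Q + k / Q * Q)          ≡⟨ ^-distribˡ-+-* x (k % Q) (k / Q * Q) ⟩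
    x ^ (k % Q) * x ^ (k / Q * Q)    ≡⟨ cong (λ e → x ^ (k % Q) * x ^ e) (*-comm (k / Q) Q) ⟩
    x ^ (k % Q) * x ^ (Q * (k / Q))  ≡⟨ cong (x ^ (k % Q) *_) (^-*-assoc x Q (k / Q)) ⟨
    x ^ (k % Q) * (x ^ Q) ^ (k / Q)
      ≈⟨ *-cong (≈-refl {x ^ (k % Q)}) (^-congˡ (k / Q) (fermat-unit 0<x x<p)) ⟩
    x ^ (k % Q) * 1 ^ (k / Q)        ≡⟨ cong (x ^ (k % Q) *_) (^-zeroˡ (k / Q)) ⟩
    x ^ (k % Q) * 1                  ≡⟨ *-identityʳ (x ^ (k % Q)) ⟩
    x ^ (k % Q)                      ∎
    where open ≈-Reasoning

  powerSum≈0 : ∀ k → k < Q → powerSum p k ≈ 0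
  powerSum≈0 = <-rec (λ k → k < Q → powerSum p k ≈ 0) λ k rec k<Q →
    ∣⇒≈0 (p∣*⇒∣ʳ (p∤C (s<s k<Q) (n≤1+n k)) (p∣last k rec k<Q))
    where
    p∣last : ∀ k → (∀ {j} → j < k → j < Q → powerSum p j ≈ 0) → k < Q →
             p ∣ (suc k C k) * powerSum p k
    p∣last k rec k<Q = ∣m+n∣m⇒∣n (subst (p ∣_) split (m∣m*n (p ^ k))) (≈0⇒∣ (sum≈0 earlier≈0))
      where
      g : ℕ → ℕ
      g j = (suc k C j) * powerSum p j
      split : p ^ suc k ≡ ∑[ j < k ] g (toℕ (inject₁ j)) + (suc k C k) * powerSum p k
      split = begin
        p ^ suc k                ≡⟨ powerSum-recurrence p k ⟨
        ∑[ j ≤ k ] g (toℕ j)     ≡⟨ sum-init-last {k} (g ∘ toℕ) ⟩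
        ∑[ j < k ] g (toℕ (inject₁ j)) + g (toℕ (fromℕ k))
          ≡⟨ cong (λ i → ∑[ j < k ] g (toℕ (inject₁ j)) + g i) (toℕ-fromℕ k) ⟩
        ∑[ j < k ] g (toℕ (inject₁ j)) + g k                ∎
        where open ≡-Reasoning
      earlier≈0 : ∀ j → g (toℕ (inject₁ j)) ≈ 0
      earlier≈0 j =
        ≈-trans (*-cong (≈-refl {suc k C i}) (rec i<k (<-trans i<k k<Q))) (≡⇒≈ (*-zeroʳ (suc k C i)))
        where
        i : ℕ
        i = toℕ (inject₁ j)
        i<k : i < k
        i<k = subst (_< k) (sym (toℕ-inject₁ j)) (toℕ<n j)

  powerSum≈negIndicator : ∀ k → 0 < k → powerSum p k ≈ negIndicator Q k
  powerSum≈negIndicator (suc k) _ = begin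
    powerSum p (suc k)                    ≡⟨⟩
    ∑[ c < Q ] (suc (toℕ c) ^ suc k)      ≈⟨ sum-cong {Q} (λ c → ^-%Q (suc k) z<s (s<s (toℕ<n c))) ⟩
    ∑[ c < Q ] (suc (toℕ c) ^ (suc k % Q)) ≈⟨ unitPowerSum≈ (suc k % Q) (m%n<n (suc k) Q) ⟩
    negIndicator Q (suc k)                ∎
    where
    open ≈-Reasoning
    unitPowerSum≈ : ∀ r → r < Q → ∑[ c < Q ] (suc (toℕ c) ^ r) ≈ (if r ≡ᵇ 0 then Q else 0)
    unitPowerSum≈ zero    _   = ≡⇒≈ (trans (sum-replicate Q) (trans (×ᴿ≡* Q 1) (*-identityʳ Q)))
    unitPowerSum≈ (suc r) r<Q = powerSum≈0 (suc r) r<Q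

  powerSum-binomialMap : ∀ {m n} (a : Fin p) t → 0 < n → n ≤ m → 0 < t →
    ∑[ c < p ] (toℕ (binomialMap p m n a c) ^ t) ≈ hermiteSum Q n (m ∸ n) (toℕ a) t
  powerSum-binomialMap {m} {n} a t 0<n n≤m 0<t = begin
    ∑[ c < p ] (toℕ (binomialMap p m n a c) ^ t)
      ≡⟨ sum-cong-≗ {p} (λ c → cong (_^ t) (toℕ-fromℕ< (m%n<n (toℕ c ^ m + A * toℕ c ^ n) p))) ⟩
    ∑[ c < p ] (((toℕ c ^ m + A * toℕ c ^ n) % p) ^ t)
      ≈⟨ sum-cong {p} (λ c → ^-congˡ t (%-≈ (toℕ c ^ m + A * toℕ c ^ n))) ⟩
    ∑[ c < p ] ((toℕ c ^ m + A * toℕ c ^ n) ^ t)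
      ≡⟨ sum-cong-≗ {p} (λ c → trans (cong (λ e → (toℕ c ^ e + A * toℕ c ^ n) ^ t) m≡s+n)
                                     (binomial-power-expansion s n A t (toℕ c))) ⟩
    ∑[ c < p ] ∑[ j ≤ t ] (w (toℕ j) * toℕ c ^ e (toℕ j))
      ≡⟨ ∑-comm {p} {suc t} (λ c j → w (toℕ j) * toℕ c ^ e (toℕ j)) ⟩
    ∑[ j ≤ t ] ∑[ c < p ] (w (toℕ j) * toℕ c ^ e (toℕ j))
      ≡⟨ sum-cong-≗ {suc t} (λ j →
           sym (*-distribˡ-sum {p} (w (toℕ j)) (λ c → toℕ c ^ e (toℕ j)))) ⟩
    ∑[ j ≤ t ] (w (toℕ j) * powerSum p (e (toℕ j)))
      ≈⟨ sum-cong {suc t} (λ j →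
           *-cong (≈-refl {w (toℕ j)}) (powerSum≈negIndicator (e (toℕ j)) (0<e (toℕ j)))) ⟩
    hermiteSum Q n s A t ∎
    where
    open ≈-Reasoning
    A s : ℕ
    A = toℕ a
    s = m ∸ n
    m≡s+n : m ≡ s + n
    m≡s+n = sym (m∸n+n≡m n≤m)
    w e : ℕ → ℕ
    w j = (t C j) * A ^ (t ∸ j)
    e j = n * t + s * j
    0<e : ∀ j → 0 < e j
    0<e j = <-≤-trans (*-mono-≤ 0<n 0<t) (m≤m+n (n * t) (s * j))

  -- Hermite's criterion: permuting 𝔽_p preserves the power sums, which vanish below degree Q.
  hermite : ∀ {m n} (a : Fin p) t → 0 < n → n < m → Bijective _≡_ _≡_ (binomialMap p m n a) →
            0 < t → t < Q → hermiteSum Q n (m ∸ n) (toℕ a) t ≈ 0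
  hermite {m} {n} a t 0<n n<m bij 0<t t<Q = begin
    hermiteSum Q n (m ∸ n) (toℕ a) t              ≈⟨ powerSum-binomialMap a t 0<n (<⇒≤ n<m) 0<t ⟨
    ∑[ c < p ] (toℕ (binomialMap p m n a c) ^ t)  ≡⟨ sum-bijection bij (λ c → toℕ c ^ t) ⟩
    powerSum p t                                  ≈⟨ powerSum≈0 t t<Q ⟩
    0                                             ∎
    where open ≈-Reasoning

  hermite-% : ∀ {m n} (a : Fin p) t → 0 < n → n < m → Bijective _≡_ _≡_ (binomialMap p m n a) →
              0 < t → t < Q → hermiteSum Q (n % Q) ((m ∸ n) % Q) (toℕ a) t % p ≡ 0
  hermite-% {m} {n} a t 0<n n<m bij 0<t t<Q =
    trans (cong (_% p) (sym (hermiteSum-% Q n (m ∸ n) (toℕ a) t))) (%-≡ (hermite a t 0<n n<m bij 0<t t<Q))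

  -- With Q = d r, s = d e and d < r, some Hermite sum has a single nonzero term.
  hermite-contradiction : ∀ {m n} (a : Fin p) → 0 < n → n < m → toℕ a ≢ 0 →
    Bijective _≡_ _≡_ (binomialMap p m n a) →
    ∀ {d e r} .{{_ : NonZero d}} → m ∸ n ≡ d * e → Q ≡ d * r → Coprime e r → 2 ≤ d → d < r → ⊥
  hermite-contradiction {m} {n} a 0<n n<m a≢0 bij {d} {e} {r} s≡de Q≡dr e⊥r 2≤d d<r =
    p∤* (p∤* (p∤C t<p x≤du) (p∤^ (t ∸ x) (p∤unit (n≢0⇒n>0 a≢0) (toℕ<n a))))
        (p∤unit (>-nonZero⁻¹ Q) ≤-refl)
      (≈0⇒∣ (subst (_≈ 0) single≡ (hermite a t 0<n n<m bij 0<t t<Q)))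
    where
    instance
      r-nonZero : NonZero r
      r-nonZero = >-nonZero (≤-<-trans z≤n d<r)
    c : ℕ
    c = proj₁ (coprime⇒solvable n e⊥r)
    open Window (window d r c 2≤d d<r)
    x t : ℕ
    x = (u * c) % r
    t = d * u
    0<t : 0 < t
    0<t = *-mono-≤ (≤-trans (s≤s z≤n) 2≤d) 0<u
    t<Q : t < Q
    t<Q = subst (t <_) (sym Q≡dr) (*-monoʳ-< d u<r)
    t<p : t < p
    t<p = <-trans t<Q (n<1+n Q)
    r∣nu+ex : r ∣ n * u + e * x
    r∣nu+ex = ∣-scale-% {r} {n} {e} {c} u (proj₂ (coprime⇒solvable n e⊥r))
    single≡ : hermiteSum Q n (m ∸ n) (toℕ a) t ≡ (t C x) * toℕ a ^ (t ∸ x) * Q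
    single≡ = hermiteSum-single {n = n} {u = u} (toℕ a) Q≡dr s≡de e⊥r r∣nu+ex
                                (m%n<n (u * c) r) x≤du du<x+r

-- The cases gcd (m − n) (p − 1) ∈ {2, 4}

gcd-decomposition : ∀ {s Q d} .{{_ : NonZero d}} → gcd s Q ≡ d →
                    ∃₂ λ e r → s ≡ d * e × Q ≡ d * r × Coprime e r
gcd-decomposition {s} {Q} refl =
  s / gcd s Q , Q / gcd s Q ,
  sym (m*[n/m]≡n (gcd[m,n]∣m s Q)) , sym (m*[n/m]≡n (gcd[m,n]∣n s Q)) , coprime-/gcd s Q

gcd-% : ∀ s Q .{{_ : NonZero Q}} → gcd (s % Q) Q ≡ gcd s Q
gcd-% s Q = ∣-antisym
  (gcd-greatest (∣n∣m%n⇒∣m (gcd[m,n]∣n (s % Q) Q) (gcd[m,n]∣m (s % Q) Q)) (gcd[m,n]∣n (s % Q) Q))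
  (gcd-greatest (%-presˡ-∣ (gcd[m,n]∣m s Q) (gcd[m,n]∣n s Q)) (gcd[m,n]∣n s Q))

hermiteSum-nonzero-13 : ∀ {n} → n < 12 → ∀ {s} → s < 12 → ∀ {A} → A < 13 →
  gcd s 12 ≡ 4 → A ≢ 0 → hermiteSum 12 n s A 4 % 13 ≢ 0
hermiteSum-nonzero-13 = from-yes (allUpTo? (λ n → allUpTo? (λ s → allUpTo? (λ A →
  gcd s 12 ≟ 4 →-dec ¬? (A ≟ 0) →-dec ¬? (hermiteSum 12 n s A 4 % 13 ≟ 0)) 13) 12) 12)

hermiteSum-nonzero-17 : ∀ {n} → n < 16 → ∀ {s} → s < 16 → ∀ {A} → A < 17 →
  gcd s 16 ≡ 4 → A ≢ 0 → hermiteSum 16 n s A 2 % 17 ≡ 0 → hermiteSum 16 n s A 4 % 17 ≢ 0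
hermiteSum-nonzero-17 = from-yes (allUpTo? (λ n → allUpTo? (λ s → allUpTo? (λ A →
  gcd s 16 ≟ 4 →-dec ¬? (A ≟ 0) →-dec (hermiteSum 16 n s A 2 % 17 ≟ 0) →-dec
  ¬? (hermiteSum 16 n s A 4 % 17 ≟ 0)) 17) 16) 16)

gcd≢2 : ∀ {Q} → Prime (suc Q) → 5 < suc Q →
        ∀ {m n} (a : Fin (suc Q)) → 0 < n → n < m → toℕ a ≢ 0 →
        Bijective _≡_ _≡_ (binomialMap (suc Q) m n a) → gcd (m ∸ n) Q ≢ 2
gcd≢2 {Q} p-prime 5<p a 0<n n<m a≢0 bij gcd≡2 =
  let e , r , s≡2e , Q≡2r , e⊥r = gcd-decomposition gcd≡2
  in hermite-contradiction a 0<n n<m a≢0 bij s≡2e Q≡2r e⊥r ≤-refl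
       (*-cancelˡ-< 2 2 r (subst (4 <_) Q≡2r (s<s⁻¹ 5<p)))
  where open PrimeField Q p-prime

gcd≡4⇒⊥ : ∀ {Q} → Prime (suc Q) → 5 < suc Q →
          ∀ {m n} (a : Fin (suc Q)) → 0 < n → n < m → toℕ a ≢ 0 →
          Bijective _≡_ _≡_ (binomialMap (suc Q) m n a) → gcd (m ∸ n) Q ≡ 4 →
          ∀ {e} r → m ∸ n ≡ 4 * e → Q ≡ 4 * r → Coprime e r → ⊥
gcd≡4⇒⊥ p-prime 5<p a 0<n n<m a≢0 bij gcd≡4 0 _ refl _ = ≤⇒≯ (s≤s z≤n) 5<p
gcd≡4⇒⊥ p-prime 5<p a 0<n n<m a≢0 bij gcd≡4 1 _ refl _ = ≤⇒≯ ≤-refl 5<p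
gcd≡4⇒⊥ p-prime 5<p a 0<n n<m a≢0 bij gcd≡4 2 _ refl _ = from-no (prime? 9) p-prime
gcd≡4⇒⊥ p-prime 5<p {m} {n} a 0<n n<m a≢0 bij gcd≡4 3 _ refl _ =
  hermiteSum-nonzero-13 (m%n<n n 12) (m%n<n (m ∸ n) 12) (toℕ<n a) (trans (gcd-% (m ∸ n) 12) gcd≡4) a≢0
    (hermite-% a 4 0<n n<m bij z<s (<ᵇ⇒< 4 12 _))
  where open PrimeField 12 p-prime
gcd≡4⇒⊥ p-prime 5<p {m} {n} a 0<n n<m a≢0 bij gcd≡4 4 _ refl _ =
  hermiteSum-nonzero-17 (m%n<n n 16) (m%n<n (m ∸ n) 16) (toℕ<n a) (trans (gcd-% (m ∸ n) 16) gcd≡4) a≢0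
    (hermite-% a 2 0<n n<m bij z<s (<ᵇ⇒< 2 16 _)) (hermite-% a 4 0<n n<m bij z<s (<ᵇ⇒< 4 16 _))
  where open PrimeField 16 p-prime
gcd≡4⇒⊥ {Q} p-prime 5<p a 0<n n<m a≢0 bij gcd≡4 (suc (suc (suc (suc (suc r′))))) s≡4e Q≡4r e⊥r =
  hermite-contradiction a 0<n n<m a≢0 bij s≡4e Q≡4r e⊥r (<ᵇ⇒< 1 4 _) (m≤m+n 5 r′)
  where open PrimeField Q p-prime

gcd≢4 : ∀ {Q} → Prime (suc Q) → 5 < suc Q →
        ∀ {m n} (a : Fin (suc Q)) → 0 < n → n < m → toℕ a ≢ 0 →
        Bijective _≡_ _≡_ (binomialMap (suc Q) m n a) → gcd (m ∸ n) Q ≢ 4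
gcd≢4 p-prime 5<p a 0<n n<m a≢0 bij gcd≡4 =
  let e , r , s≡4e , Q≡4r , e⊥r = gcd-decomposition gcd≡4
  in gcd≡4⇒⊥ p-prime 5<p a 0<n n<m a≢0 bij gcd≡4 r s≡4e Q≡4r e⊥r

theorem1p1 : (p : ℕ) .{{_ : NonZero p}} → Prime p → 5 < p →
    (m n : ℕ) → 0 < n → n < m →
    (a : Fin p) → ¬ (toℕ a ≡ 0) →
    Bijective _≡_ _≡_ (binomialMap p m n a) →
    ¬ (gcd (m ∸ n) (p ∸ 1) ≡ 2 ⊎ gcd (m ∸ n) (p ∸ 1) ≡ 4)
theorem1p1 (suc Q) p-prime 5<p m n 0<n n<m a a≢0 bij =
  [ gcd≢2 p-prime 5<p a 0<n n<m a≢0 bij , gcd≢4 p-prime 5<p a 0<n n<m a≢0 bij ]′
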